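{- Let $X\subseteq B^n$ be well-behaved. Then $s(X)=0$ if and only if $|X|\le n+1$.
   Context: $B=\{0,1\}$. A comparator $[i,j]$ replaces $x_i$ by $\min(x_i,x_j)$ and $x_j$ by $\max(x_i,x_j)$; an exchange $(i,j)$ swaps entries $i,j$. A comparator network on $n$ channels is a finite sequence of comparators and exchanges applied left to right; its size is its number of comparators. For $X\subseteq B^n$, $s(X)$ is the minimal size of a comparator network whose output on every $x\in X$ is sorted (nondecreasing). Threshold sets: for a permutation $y$ of $(1,\dots,n)$, $T(y)=\{([y_1\ge k],\dots,[y_n\ge k])\mid 1\le k\le n+1\}$, where $[P]=1$ if $P$ holds and $0$ otherwise. $X\subseteq B^n$ is well-behaved if it is a union of threshold sets. -}

module Defs where

open import Data.Nat using (ℕ; suc; _≤_)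
open import Data.Bool using (Bool; true; false; _∧_; _∨_)
import Data.Bool as 𝔹
open import Data.Fin using (Fin; toℕ)
import Data.Fin as F
open import Data.Fin.Permutation using (Permutation′; _⟨$⟩ʳ_)
open import Data.Vec using (Vec; lookup; tabulate; _[_]≔_)
open import Data.List using (List; []; _∷_; length)
open import Data.List.Membership.Propositional using (_∈_)
open import Data.List.Relation.Unary.Unique.Propositional using (Unique)
open import Data.Product using (Σ; ∃; ∃-syntax; _×_)
open import Relation.Nullary.Decidable using (does)
open import Data.Nat using (_≤?_)
open import Function.Bundles using (_⇔_)
open import Relation.Binary.PropositionalEquality using (_≡_)

-- Binary words B^n, with B = Bool (false = 0, true = 1).
Word : ℕ → Set
Word n = Vec Bool n

data Gate (n : ℕ) : Set where
  cmp  : Fin n → Fin n → Gate n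
  exch : Fin n → Fin n → Gate n

Network : ℕ → Set
Network n = List (Gate n)

applyGate : ∀ {n} → Gate n → Word n → Word n
applyGate (cmp i j) x =
  (x [ i ]≔ (lookup x i ∧ lookup x j)) [ j ]≔ (lookup x i ∨ lookup x j)
applyGate (exch i j) x =
  (x [ i ]≔ lookup x j) [ j ]≔ lookup x i

run : ∀ {n} → Network n → Word n → Word n
run []       x = x
run (g ∷ gs) x = run gs (applyGate g x)

size : ∀ {n} → Network n → ℕ
size []             = 0
size (cmp _ _ ∷ gs)  = suc (size gs)
size (exch _ _ ∷ gs) = size gs

Sorted : ∀ {n} → Word n → Set
Sorted {n} x = ∀ (i j : Fin n) → i F.≤ j → lookup x i 𝔹.≤ lookup x j

-- A finite subset X ⊆ B^n is a duplicate-free list of words; |X| = length.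
record WordSet (n : ℕ) : Set where
  field
    elems  : List (Word n)
    unique : Unique elems
open WordSet public

_∈S_ : ∀ {n} → Word n → WordSet n → Set
x ∈S X = x ∈ elems X

card : ∀ {n} → WordSet n → ℕ
card X = length (elems X)

SortsAll : ∀ {n} → Network n → WordSet n → Set
SortsAll net X = ∀ x → x ∈S X → Sorted (run net x)

IsS : ∀ {n} → WordSet n → ℕ → Set
IsS {n} X k =
  (Σ (Network n) λ net → size net ≡ k × SortsAll net X)
  × (∀ (net : Network n) → SortsAll net X → k ≤ size net)

-- A permutation y of (1,…,n), given by σ : Fin n ↔ Fin n, y_i = 1 + σ(i).
yval : ∀ {n} → Permutation′ n → Fin n → ℕ
yval σ i = suc (toℕ (σ ⟨$⟩ʳ i))

thresholdWord : ∀ {n} → Permutation′ n → ℕ → Word n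
thresholdWord σ k = tabulate (λ i → does (k ≤? yval σ i))

_∈T_ : ∀ {n} → Word n → Permutation′ n → Set
_∈T_ {n} x σ = ∃[ k ] (1 ≤ k × k ≤ suc n × x ≡ thresholdWord σ k)

WellBehaved : ∀ {n} → WordSet n → Set
WellBehaved {n} X =
  ∃[ ys ] (∀ (x : Word n) → (x ∈S X) ⇔ (∃[ σ ] (σ ∈ ys × x ∈T σ)))

-- A network without comparators only permutes channels, so it is injective on
-- words, while a sorted word is determined by its number of ones, one of n + 1
-- values; hence such a network sorts at most n + 1 distinct words. Conversely,
-- a well-behaved X contains the n + 1 distinct words of some threshold set
-- T(y), so |X| ≤ n + 1 forces X = T(y) (or X = ∅), and the exchanges routing
-- channel y⁻¹(m) to position m turn every threshold word [y_i ≥ k] into the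
-- sorted word [m + 1 ≥ k].
module Submission where

open import Defs
open import Data.Nat using (ℕ; suc; _≤_)
open import Function.Bundles using (_⇔_)

open import Data.Bool using (true; false)
import Data.Bool as 𝔹
import Data.Bool.Properties as 𝔹ₚ
open import Data.Nat using (zero; z≤n; s≤s; _<_; _≤?_)
open import Data.Nat.Properties using (≤-refl; ≤-trans; <-≤-trans; <⇒≱; m≤n⇒m≤1+n; 1+n≰n; suc-injective)
open import Data.Fin using (Fin; toℕ; fromℕ<; _≟_) renaming (zero to 0F; suc to 1+_)
import Data.Fin as Fin
open import Data.Fin.Properties using (injective⇒≤; toℕ<n; toℕ≤pred[n]; toℕ-fromℕ<; fromℕ<-injective; <-cmp)
open import Data.Fin.Permutation
  using (Permutation′; _⟨$⟩ʳ_; _⟨$⟩ˡ_; _≈_; _∘ₚ_; flip; transpose; remove; lift₀;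
         insert-remove; insert-punchIn; inverseʳ)
import Data.Fin.Permutation.Components as PC
open import Data.Vec using (Vec; []; _∷_; lookup; tabulate; _[_]≔_)
open import Data.Vec.Properties using (lookup∘update; lookup∘update′; lookup∘tabulate; tabulate∘lookup; tabulate-cong)
open import Data.List using (List; length) renaming ([] to []ₗ; _∷_ to _∷ₗ_)
import Data.List as List
open import Data.List.Membership.Propositional using (_∈_)
open import Data.List.Membership.Propositional.Properties using (∈-lookup)
open import Data.List.Membership.Setoid.Properties using (index-injective)
open import Data.List.Relation.Unary.Any using (here)
import Data.List.Relation.Unary.All as All
open import Data.List.Relation.Unary.AllPairs using (_∷_)
open import Data.List.Relation.Unary.Unique.Propositional using (Unique)
open import Data.Product using (Σ; _×_; _,_)
open import Function using (Injective; _∘_)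
open import Function.Bundles using (mk⇔; Equivalence)
open import Relation.Binary using (tri<; tri≈; tri>)
open import Relation.Binary.PropositionalEquality
open import Relation.Nullary using (¬_; yes; no; does; contradiction)
open import Relation.Nullary.Decidable using (dec-true; dec-false; decidable-stable)

private
  variable
    n : ℕ

lookup-extensionality : ∀ {A : Set} {m} {x y : Vec A m} → lookup x ≗ lookup y → x ≡ y
lookup-extensionality {x = x} {y} x≗y = begin
  x                   ≡⟨ sym (tabulate∘lookup x) ⟩
  tabulate (lookup x) ≡⟨ tabulate-cong x≗y ⟩
  tabulate (lookup y) ≡⟨ tabulate∘lookup y ⟩
  y                   ∎
  where open ≡-Reasoning

exch-lookup : ∀ (i j k : Fin n) (x : Word n) →
              lookup (applyGate (exch i j) x) k ≡ lookup x (PC.transpose j i k)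
exch-lookup i j k x with k ≟ j
... | yes refl = lookup∘update k (x [ i ]≔ lookup x k) (lookup x i)
... | no k≢j rewrite lookup∘update′ k≢j (x [ i ]≔ lookup x j) (lookup x i) with k ≟ i
...   | yes refl = lookup∘update k x (lookup x j)
...   | no k≢i   = lookup∘update′ k≢i x (lookup x j)

exch-injective : ∀ (i j : Fin n) {x y : Word n} →
                 applyGate (exch i j) x ≡ applyGate (exch i j) y → x ≡ y
exch-injective i j {x} {y} eq = lookup-extensionality λ k →
  let k′ = PC.transpose i j k in begin
  lookup x k                          ≡⟨ cong (lookup x) (sym (PC.transpose-inverse j i)) ⟩
  lookup x (PC.transpose j i k′)      ≡⟨ sym (exch-lookup i j k′ x) ⟩
  lookup (applyGate (exch i j) x) k′  ≡⟨ cong (λ v → lookup v k′) eq ⟩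
  lookup (applyGate (exch i j) y) k′  ≡⟨ exch-lookup i j k′ y ⟩
  lookup y (PC.transpose j i k′)      ≡⟨ cong (lookup y) (PC.transpose-inverse j i) ⟩
  lookup y k                          ∎
  where open ≡-Reasoning

run-injective : ∀ (net : Network n) → size net ≡ 0 → ∀ {x y} → run net x ≡ run net y → x ≡ y
run-injective []ₗ               _     eq = eq
run-injective (cmp _ _ ∷ₗ _)     ()
run-injective (exch i j ∷ₗ net) size0 eq = exch-injective i j (run-injective net size0 eq)

ones : Word n → ℕ
ones []          = 0
ones (true ∷ x)  = suc (ones x)
ones (false ∷ x) = ones x

ones≤length : ∀ (x : Word n) → ones x ≤ n
ones≤length []          = z≤n
ones≤length (true ∷ x)  = s≤s (ones≤length x)
ones≤length (false ∷ x) = m≤n⇒m≤1+n (ones≤length x)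

Sorted-∷⁻ : ∀ {a} {x : Word n} → Sorted (a ∷ x) → Sorted x
Sorted-∷⁻ sorted i j i≤j = sorted (1+ i) (1+ j) (s≤s i≤j)

ones-allTrue : ∀ (x : Word n) → (∀ k → true 𝔹.≤ lookup x k) → ones x ≡ n
ones-allTrue []          _    = refl
ones-allTrue (true ∷ x)  true≤ = cong suc (ones-allTrue x (λ k → true≤ (1+ k)))
ones-allTrue (false ∷ x) true≤ with true≤ 0F
... | ()

ones-Sorted-true∷ : ∀ {x : Word n} → Sorted (true ∷ x) → ones x ≡ n
ones-Sorted-true∷ {x = x} sorted = ones-allTrue x (λ k → sorted 0F (1+ k) z≤n)

Sorted-ones-injective : ∀ {x y : Word n} → Sorted x → Sorted y → ones x ≡ ones y → x ≡ y
Sorted-ones-injective {x = []}    {[]}    _  _  _  = refl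
Sorted-ones-injective {x = a ∷ x} {b ∷ y} sx sy eq with a | b
... | true  | true  = cong (true ∷_)  (Sorted-ones-injective (Sorted-∷⁻ sx) (Sorted-∷⁻ sy) (suc-injective eq))
... | false | false = cong (false ∷_) (Sorted-ones-injective (Sorted-∷⁻ sx) (Sorted-∷⁻ sy) eq)
... | false | true  = contradiction (subst (_≤ _) eq′ (ones≤length x)) 1+n≰n
  where eq′ = trans eq (cong suc (ones-Sorted-true∷ sy))
... | true  | false = contradiction (subst (_≤ _) eq′ (ones≤length y)) 1+n≰n
  where eq′ = trans (sym eq) (cong suc (ones-Sorted-true∷ sx))

Unique-lookup-injective : ∀ {A : Set} {xs : List A} → Unique xs → Injective _≡_ _≡_ (List.lookup xs)
Unique-lookup-injective {xs = _ ∷ₗ _} (_   ∷ _)      {0F}   {0F}   _  = refl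
Unique-lookup-injective {xs = _ ∷ₗ _} (x∉ ∷ _)      {0F}   {1+ j} eq = contradiction eq (All.lookup x∉ (∈-lookup j))
Unique-lookup-injective {xs = _ ∷ₗ _} (x∉ ∷ _)      {1+ i} {0F}   eq = contradiction (sym eq) (All.lookup x∉ (∈-lookup i))
Unique-lookup-injective {xs = _ ∷ₗ _} (_   ∷ unique) {1+ i} {1+ j} eq = cong 1+_ (Unique-lookup-injective unique eq)

Unique⇒length≤ : ∀ {A : Set} {m} {xs : List A} → Unique xs → (f : A → Fin m) →
                 (∀ {x y} → x ∈ xs → y ∈ xs → f x ≡ f y → x ≡ y) → length xs ≤ m
Unique⇒length≤ unique f f-injective = injective⇒≤ λ {i} {j} eq →
  Unique-lookup-injective unique (f-injective (∈-lookup i) (∈-lookup j) eq)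

injective-∈⇒≤length : ∀ {A : Set} {m} {xs : List A} (w : Fin m → A) → Injective _≡_ _≡_ w →
                      (∀ i → w i ∈ xs) → m ≤ length xs
injective-∈⇒≤length {A = A} w w-injective w∈xs = injective⇒≤ λ {i} {j} eq →
  w-injective (index-injective (setoid A) (w∈xs i) (w∈xs j) eq)

comparatorFree-sorts⇒card≤ : ∀ (X : WordSet n) (net : Network n) → size net ≡ 0 →
                             SortsAll net X → card X ≤ suc n
comparatorFree-sorts⇒card≤ {n} X net size0 sorts = Unique⇒length≤ (unique X) onesOfOutput injectiveOnX
  where
  onesOfOutput : Word n → Fin (suc n)
  onesOfOutput x = fromℕ< (s≤s (ones≤length (run net x)))

  injectiveOnX : ∀ {x y} → x ∈S X → y ∈S X → onesOfOutput x ≡ onesOfOutput y → x ≡ y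
  injectiveOnX {x} {y} x∈X y∈X eq = run-injective net size0
    (Sorted-ones-injective (sorts x x∈X) (sorts y y∈X) (fromℕ<-injective _ _ _ _ eq))

liftGate : Gate n → Gate (suc n)
liftGate (cmp i j)  = cmp (1+ i) (1+ j)
liftGate (exch i j) = exch (1+ i) (1+ j)

liftNetwork : Network n → Network (suc n)
liftNetwork = List.map liftGate

size-liftNetwork : ∀ (net : Network n) → size (liftNetwork net) ≡ size net
size-liftNetwork []ₗ               = refl
size-liftNetwork (cmp _ _ ∷ₗ net)  = cong suc (size-liftNetwork net)
size-liftNetwork (exch _ _ ∷ₗ net) = size-liftNetwork net

run-liftNetwork : ∀ (net : Network n) a x → run (liftNetwork net) (a ∷ x) ≡ a ∷ run net x
run-liftNetwork []ₗ               a x = refl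
run-liftNetwork (cmp _ _ ∷ₗ net)  a x = run-liftNetwork net a _
run-liftNetwork (exch _ _ ∷ₗ net) a x = run-liftNetwork net a _

Realises : Network n → Permutation′ n → Set
Realises {n} net π = ∀ (x : Word n) k → lookup (run net x) k ≡ lookup x (π ⟨$⟩ʳ k)

Realises-lift : ∀ (net : Network n) {π} → Realises net π → Realises (liftNetwork net) (lift₀ π)
Realises-lift net realises (a ∷ x) 0F =
  cong (λ v → lookup v 0F) (run-liftNetwork net a x)
Realises-lift net realises (a ∷ x) (1+ k) =
  trans (cong (λ v → lookup v (1+ k)) (run-liftNetwork net a x)) (realises x k)

transposeᵢⱼj≡i : ∀ (i j : Fin n) → PC.transpose i j j ≡ i
transposeᵢⱼj≡i i j with j ≟ i
... | yes j≡i = j≡i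
... | no _ with j ≟ j
...   | yes _   = refl
...   | no j≢j  = contradiction refl j≢j

lift₀-remove : ∀ (π : Permutation′ (suc n)) → π ⟨$⟩ʳ 0F ≡ 0F → lift₀ (remove 0F π) ≈ π
lift₀-remove π π0≡0 0F     = sym π0≡0
lift₀-remove π π0≡0 (1+ k) = begin
  1+ (remove 0F π ⟨$⟩ʳ k)                           ≡⟨ cong (λ z → Fin.punchIn z (remove 0F π ⟨$⟩ʳ k)) (sym π0≡0) ⟩
  Fin.punchIn (π ⟨$⟩ʳ 0F) (remove 0F π ⟨$⟩ʳ k)      ≡⟨ sym (insert-punchIn 0F (π ⟨$⟩ʳ 0F) (remove 0F π) k) ⟩
  _                                                 ≡⟨ insert-remove 0F π (1+ k) ⟩
  π ⟨$⟩ʳ 1+ k                                       ∎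
  where open ≡-Reasoning

-- Composed with the transposition of 0 and π(0), π fixes 0 and so restricts
-- to a permutation of the remaining channels.
tailPermutation : Permutation′ (suc n) → Permutation′ n
tailPermutation π = remove 0F (π ∘ₚ transpose 0F (π ⟨$⟩ʳ 0F))

exchangeNetwork : Permutation′ n → Network n
exchangeNetwork {zero}  π = []ₗ
exchangeNetwork {suc n} π = exch 0F (π ⟨$⟩ʳ 0F) ∷ₗ liftNetwork (exchangeNetwork (tailPermutation π))

size-exchangeNetwork : ∀ (π : Permutation′ n) → size (exchangeNetwork π) ≡ 0
size-exchangeNetwork {zero}  π = refl
size-exchangeNetwork {suc n} π =
  trans (size-liftNetwork (exchangeNetwork (tailPermutation π))) (size-exchangeNetwork (tailPermutation π))

exchangeNetwork-realises : ∀ (π : Permutation′ n) → Realises (exchangeNetwork π) π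
exchangeNetwork-realises {zero}  π _ ()
exchangeNetwork-realises {suc n} π x k = begin
  lookup (run (liftNetwork rest) (applyGate (exch 0F j) x)) k
    ≡⟨ Realises-lift rest (exchangeNetwork-realises (tailPermutation π)) (applyGate (exch 0F j) x) k ⟩
  lookup (applyGate (exch 0F j) x) (lift₀ (tailPermutation π) ⟨$⟩ʳ k)
    ≡⟨ exch-lookup 0F j _ x ⟩
  lookup x (PC.transpose j 0F (lift₀ (tailPermutation π) ⟨$⟩ʳ k))
    ≡⟨ cong (lookup x ∘ PC.transpose j 0F) (lift₀-remove (π ∘ₚ transpose 0F j) (transposeᵢⱼj≡i 0F j) k) ⟩
  lookup x (PC.transpose j 0F (PC.transpose 0F j (π ⟨$⟩ʳ k)))
    ≡⟨ cong (lookup x) (PC.transpose-inverse j 0F) ⟩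
  lookup x (π ⟨$⟩ʳ k)
    ∎
  where
  open ≡-Reasoning
  j    = π ⟨$⟩ʳ 0F
  rest = exchangeNetwork (tailPermutation π)

lookup-thresholdWord : ∀ (σ : Permutation′ n) K m →
                       lookup (thresholdWord σ K) (σ ⟨$⟩ˡ m) ≡ does (K ≤? suc (toℕ m))
lookup-thresholdWord σ K m = trans (lookup∘tabulate _ (σ ⟨$⟩ˡ m))
                                   (cong (λ z → does (K ≤? suc (toℕ z))) (inverseʳ σ))

does-≤?-mono : ∀ K {a b} → a ≤ b → does (K ≤? a) 𝔹.≤ does (K ≤? b)
does-≤?-mono K {a} {b} a≤b with K ≤? b
... | yes K≤b rewrite dec-true (K ≤? b) K≤b = 𝔹ₚ.≤-maximum _
... | no K≰b  rewrite dec-false (K ≤? a) (λ K≤a → K≰b (≤-trans K≤a a≤b)) = 𝔹ₚ.≤-minimum _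

thresholdWord-sorted : ∀ (σ : Permutation′ n) net → Realises net (flip σ) →
                       ∀ K → Sorted (run net (thresholdWord σ K))
thresholdWord-sorted σ net realises K i j i≤j =
  subst₂ 𝔹._≤_ (sym (output i)) (sym (output j)) (does-≤?-mono K (s≤s i≤j))
  where
  output : ∀ m → lookup (run net (thresholdWord σ K)) m ≡ does (K ≤? suc (toℕ m))
  output m = trans (realises (thresholdWord σ K) m) (lookup-thresholdWord σ K m)

thresholdWord-separates : ∀ (σ : Permutation′ n) {a b} → a < b → b ≤ n →
                          thresholdWord σ (suc a) ≢ thresholdWord σ (suc b)
thresholdWord-separates σ {a} {b} a<b b≤n eq = contradiction (begin
  true                                   ≡⟨ sym (dec-true (suc a ≤? suc a) ≤-refl) ⟩
  does (suc a ≤? suc a)                  ≡⟨ sym (at (suc a)) ⟩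
  lookup (thresholdWord σ (suc a)) p     ≡⟨ cong (λ v → lookup v p) eq ⟩
  lookup (thresholdWord σ (suc b)) p     ≡⟨ at (suc b) ⟩
  does (suc b ≤? suc a)                  ≡⟨ dec-false (suc b ≤? suc a) (<⇒≱ (s≤s a<b)) ⟩
  false                                  ∎) λ ()
  where
  open ≡-Reasoning
  c = fromℕ< (<-≤-trans a<b b≤n)
  p = σ ⟨$⟩ˡ c
  at : ∀ K → lookup (thresholdWord σ K) p ≡ does (K ≤? suc a)
  at K = trans (lookup-thresholdWord σ K c) (cong (λ z → does (K ≤? suc z)) (toℕ-fromℕ< _))

thresholdWord-injective : ∀ (σ : Permutation′ n) →
                          Injective _≡_ _≡_ (λ (a : Fin (suc n)) → thresholdWord σ (suc (toℕ a)))
thresholdWord-injective σ {a} {b} eq with <-cmp a b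
... | tri< a<b _ _ = contradiction eq (thresholdWord-separates σ a<b (toℕ≤pred[n] b))
... | tri≈ _ a≡b _ = a≡b
... | tri> _ _ b<a = contradiction (sym eq) (thresholdWord-separates σ b<a (toℕ≤pred[n] a))

-- The n + 1 threshold words together with a word outside T(σ) would be
-- n + 2 distinct members of X.
card≤⇒⊆thresholdSet : ∀ (X : WordSet n) (σ : Permutation′ n) → card X ≤ suc n →
                      (∀ K → 1 ≤ K → K ≤ suc n → thresholdWord σ K ∈S X) →
                      ∀ {x} → x ∈S X → ¬ ¬ x ∈T σ
card≤⇒⊆thresholdSet {n} X σ card≤ T⊆X {x} x∈X x∉T =
  <⇒≱ (injective-∈⇒≤length w w-injective w∈X) card≤
  where
  w : Fin (suc (suc n)) → Word n
  w 0F     = x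
  w (1+ a) = thresholdWord σ (suc (toℕ a))

  w-injective : Injective _≡_ _≡_ w
  w-injective {0F}   {0F}   _  = refl
  w-injective {0F}   {1+ b} eq = contradiction (suc (toℕ b) , s≤s z≤n , toℕ<n b , eq) x∉T
  w-injective {1+ a} {0F}   eq = contradiction (suc (toℕ a) , s≤s z≤n , toℕ<n a , sym eq) x∉T
  w-injective {1+ a} {1+ b} eq = cong 1+_ (thresholdWord-injective σ eq)

  w∈X : ∀ i → w i ∈S X
  w∈X 0F     = x∈X
  w∈X (1+ a) = T⊆X _ (s≤s z≤n) (toℕ<n a)

wellBehaved-card≤⇒comparatorFree-sorts : ∀ (X : WordSet n) → WellBehaved X → card X ≤ suc n →
                                         Σ (Network n) λ net → size net ≡ 0 × SortsAll net X
wellBehaved-card≤⇒comparatorFree-sorts X ([]ₗ , cover) _ =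
  []ₗ , refl , λ x x∈X → empty (Equivalence.to (cover x) x∈X)
  where
  empty : ∀ {x} → Σ _ (λ σ → σ ∈ []ₗ × x ∈T σ) → Sorted x
  empty (_ , () , _)
wellBehaved-card≤⇒comparatorFree-sorts {n} X (σ ∷ₗ _ , cover) card≤ =
  net , size-exchangeNetwork (flip σ) , sorts
  where
  net = exchangeNetwork (flip σ)

  T⊆X : ∀ K → 1 ≤ K → K ≤ suc n → thresholdWord σ K ∈S X
  T⊆X K 1≤K K≤n+1 = Equivalence.from (cover (thresholdWord σ K)) (σ , here refl , K , 1≤K , K≤n+1 , refl)

  -- Comparisons of bits are decidable, so the double negation can be dropped.
  sorts : SortsAll net X
  sorts x x∈X i j i≤j = decidable-stable (lookup (run net x) i 𝔹ₚ.≤? lookup (run net x) j)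
    λ ¬≤ → card≤⇒⊆thresholdSet X σ card≤ T⊆X x∈X λ where
      (K , _ , _ , refl) → ¬≤ (thresholdWord-sorted σ net (exchangeNetwork-realises (flip σ)) K i j i≤j)

mainTheorem16 : ∀ (n : ℕ) (X : WordSet n) → WellBehaved X →
    (IsS X 0 ⇔ card X ≤ suc n)
mainTheorem16 n X wellBehaved = mk⇔
  (λ { ((net , size0 , sorts) , _) → comparatorFree-sorts⇒card≤ X net size0 sorts })
  (λ card≤ → wellBehaved-card≤⇒comparatorFree-sorts X wellBehaved card≤ , λ _ _ → z≤n)
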